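{- For every positive integer $d$, every $312$-avoiding affine permutation $\pi\in\widetilde{\mathfrak S}_d$ has a cut point.
   Context: An affine permutation $\pi\in\widetilde{\mathfrak S}_d$ is a bijection $\pi:\mathbb Z\to\mathbb Z$ such that $\pi(i+d)=\pi(i)+d$ for all $i\in\mathbb Z$ and $\sum_{i=0}^{d-1}(\pi(i)-i)=0$. It is $312$-avoiding if there are no integers $i<j<k$ with $\pi(j)<\pi(k)<\pi(i)$. A cut point of $\pi$ is an integer $j$ such that $\pi(i)<\pi(k)$ for all integers $i\le j<k$. -}

module Defs where

open import Data.Nat using (ℕ; zero; suc)
open import Data.Integer using (ℤ; +_; _+_; _-_; _<_; _≤_; 0ℤ)
open import Data.Product using (_×_; ∃-syntax)
open import Function.Definitions using (Bijective)
open import Relation.Binary.PropositionalEquality using (_≡_)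
open import Relation.Nullary using (¬_)

sumUpTo : ℕ → (ℤ → ℤ) → ℤ
sumUpTo zero    f = 0ℤ
sumUpTo (suc n) f = sumUpTo n f + f (+ n)

record IsAffinePerm (d : ℕ) (π : ℤ → ℤ) : Set where
  field
    bijective : Bijective _≡_ _≡_ π
    periodic  : ∀ i → π (i + + d) ≡ π i + + d
    sumZero   : sumUpTo d (λ i → π i - i) ≡ 0ℤ

Avoids312 : (ℤ → ℤ) → Set
Avoids312 π = ¬ (∃[ i ] ∃[ j ] ∃[ k ] (i < j × j < k × π j < π k × π k < π i))

IsCutPoint : (ℤ → ℤ) → ℤ → Set
IsCutPoint π j = ∀ i k → i ≤ j → j < k → π i < π k

-- The displacement k ↦ π k − k is periodic, so it attains a minimum at some p.
-- Then π p < π k for every k > p, because π k − π p ≥ k − p > 0.  If i < p < k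
-- had π i > π k, the values π p < π k < π i would form a 312 pattern, so p is a
-- cut point (injectivity rules out π i = π k).
module Submission where

open import Defs
open import Data.Nat using (ℕ; zero; suc; NonZero)
open import Data.Integer
  using (ℤ; +_; -[1+_]; _+_; _-_; _*_; -_; _≤_; _<_; _/ℕ_; _%ℕ_)
open import Data.Integer.Properties
  using ( ≤-totalOrder; ≤-<-trans; <-cmp; <-irrefl; <-asym; _≟_; ≤∧≢⇒<
        ; *-zeroˡ; +-identityʳ; +-monoˡ-≤; +-monoʳ-<)
open import Data.Integer.DivMod using (a≡a%ℕn+[a/ℕn]*n; n%ℕd<d)
open import Data.Integer.Tactic.RingSolver using (solve-∀)
open import Data.List using (upTo)
open import Data.List.Extrema ≤-totalOrder using (argmin; f[argmin]≤f[xs])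
open import Data.List.Membership.Propositional.Properties using (∈-upTo⁺)
open import Data.List.Relation.Unary.All using (lookup)
open import Data.Product using (∃-syntax; _,_; proj₁)
open import Function using (_∘_)
open import Function.Definitions using (Injective)
open import Relation.Binary.Definitions using (tri<; tri≈; tri>)
open import Relation.Binary.PropositionalEquality
open import Relation.Nullary using (yes; no)
open import Data.Empty using (⊥-elim)

module _ (n : ℕ) .{{_ : NonZero n}} {f : ℤ → ℤ} (f-periodic : ∀ i → f (i + + n) ≡ f i) where

  periodic-+ℕ* : ∀ q i → f (i + + q * + n) ≡ f i
  periodic-+ℕ* zero    i = cong f (trans (cong (λ w → i + w) (*-zeroˡ (+ n))) (+-identityʳ i))
  periodic-+ℕ* (suc q) i = begin
    f (i + + suc q * + n)        ≡⟨ cong f (shift i (+ q) (+ n)) ⟩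
    f ((i + + q * + n) + + n)    ≡⟨ f-periodic (i + + q * + n) ⟩
    f (i + + q * + n)            ≡⟨ periodic-+ℕ* q i ⟩
    f i                          ∎
    where
    open ≡-Reasoning
    shift : ∀ (i q n : ℤ) → i + (+ 1 + q) * n ≡ (i + q * n) + n
    shift = solve-∀

  periodic-+* : ∀ q i → f (i + q * + n) ≡ f i
  periodic-+* (+ q)    i = periodic-+ℕ* q i
  periodic-+* -[1+ q ] i = sym (begin
    f i                                          ≡⟨ cong f (unshift i (+ suc q) (+ n)) ⟨
    f ((i + - + suc q * + n) + + suc q * + n)    ≡⟨ periodic-+ℕ* (suc q) _ ⟩
    f (i + -[1+ q ] * + n)                       ∎)
    where
    open ≡-Reasoning
    unshift : ∀ (i m n : ℤ) → (i + - m * n) + m * n ≡ i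
    unshift = solve-∀

  periodic-%ℕ : ∀ k → f k ≡ f (+ (k %ℕ n))
  periodic-%ℕ k = trans (cong f (a≡a%ℕn+[a/ℕn]*n k n)) (periodic-+* (k /ℕ n) (+ (k %ℕ n)))

  periodic-minimum : ∃[ p ] ∀ k → f p ≤ f k
  periodic-minimum = + p , λ k →
    subst (f (+ p) ≤_) (sym (periodic-%ℕ k))
          (lookup (f[argmin]≤f[xs] {f = f ∘ +_} 0 (upTo n)) (∈-upTo⁺ (n%ℕd<d k n)))
    where
    p : ℕ
    p = argmin (f ∘ +_) 0 (upTo n)

displacement : (ℤ → ℤ) → ℤ → ℤ
displacement π k = π k - k

displacement-periodic : ∀ π n → (∀ i → π (i + + n) ≡ π i + + n) →
                        ∀ i → displacement π (i + + n) ≡ displacement π i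
displacement-periodic π n π-periodic i =
  trans (cong (_- (i + + n)) (π-periodic i)) (cancel (π i) i (+ n))
  where
  cancel : ∀ (a b c : ℤ) → (a + c) - (b + c) ≡ a - b
  cancel = solve-∀

min-displacement⇒<-after : ∀ {π p} → (∀ k → displacement π p ≤ displacement π k) →
                           ∀ {k} → p < k → π p < π k
min-displacement⇒<-after {π} {p} p-min {k} p<k = subst₂ _<_ (recover (π p) p) (recover (π k) k)
  (≤-<-trans (+-monoˡ-≤ p (p-min k)) (+-monoʳ-< (displacement π k) p<k))
  where
  recover : ∀ (a b : ℤ) → (a - b) + b ≡ a
  recover = solve-∀

<-after⇒cutPoint : ∀ {π p} → Injective _≡_ _≡_ π → Avoids312 π →
                   (∀ {k} → p < k → π p < π k) → IsCutPoint π p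
<-after⇒cutPoint {π} {p} π-injective avoids p-below i k i≤p p<k with <-cmp (π i) (π k)
... | tri< πi<πk _ _ = πi<πk
... | tri≈ _ πi≡πk _ = ⊥-elim (<-irrefl (π-injective πi≡πk) (≤-<-trans i≤p p<k))
... | tri> _ _ πi>πk with i ≟ p
...   | yes refl = ⊥-elim (<-asym πi>πk (p-below p<k))
...   | no  i≢p  = ⊥-elim (avoids (i , p , k , ≤∧≢⇒< i≤p i≢p , p<k , p-below p<k , πi>πk))

corollary4p3 : (d : ℕ) → (π : ℤ → ℤ) → IsAffinePerm (suc d) π → Avoids312 π →
    ∃[ j ] IsCutPoint π j
corollary4p3 d π affine avoids =
  let open IsAffinePerm affine
      p , p-min = periodic-minimum (suc d) (displacement-periodic π (suc d) periodic)
  in p , <-after⇒cutPoint (proj₁ bijective) avoids (min-displacement⇒<-after {π} p-min)
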